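{- Every $\mathrm{MSO}_1$-orderable class of graphs $\mathcal C$ has property $\mathsf{CUT}(f)$ for some elementary function $f$.
   Context: Graphs are finite, simple, undirected. For $G=\langle V,E\rangle$, $\lfloor G\rfloor=\langle V,\mathrm{edg}\rangle$; $\mathcal C$ is $\mathrm{MSO}_1$-orderable if there is an MSO-formula $\varphi(x,y;\bar Z)$ such that for each nonempty $G\in\mathcal C$ there are sets $\bar P\subseteq V$ with $\{(a,b):\lfloor G\rfloor\models\varphi(a,b;\bar P)\}$ a linear order on $V$. A graph with ports in $[k]$ is a graph with a vertex labelling by $[k]=\{0,\dots,k-1\}$; for $R\subseteq[k]\times[k]$, $G\otimes_R H$ is the disjoint union plus all edges $(x,y)$ between $x$ in one graph and $y$ in the other whose port labels form a pair in $R$; $\mathrm{Del}$ deletes port labels. $\mathrm{Cut}(G,k)$ is the maximal $n$ such that there are nonempty graphs $H_0,\dots,H_{n-1}$ with ports in $[k]$ and $R$ with $G\cong\mathrm{Del}(H_0\otimes_R\cdots\otimes_R H_{n-1})$. $\mathcal C$ has $\mathsf{CUT}(f)$ if $\mathrm{Cut}(G,k)\le f(k)$ for all $G\in\mathcal C$, $k\in\mathbb N$. A function is elementary if it is bounded by $\exp_j$ for fixed $j$, where $\exp_0(n)=n$, $\exp_{j+1}(n)=2^{\exp_j(n)}$. -}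

module Defs where

open import Data.Nat using (ℕ; zero; suc; _+_; _^_; _≤_; _<_)
open import Data.Fin using (Fin; splitAt)
open import Data.Bool using (Bool; true; false; _∨_; T)
open import Data.Sum using (_⊎_; inj₁; inj₂)
open import Data.Product using (Σ; _×_; ∃; ∃-syntax; _,_)
open import Data.Empty using (⊥)
open import Relation.Nullary using (¬_)
open import Relation.Binary.PropositionalEquality using (_≡_)
open import Relation.Binary.Structures using (IsTotalOrder)
open import Function.Bundles using (_⤖_; Bijection)
open import Data.Vec.Functional using (_∷_)

record Graph : Set where
  field
    size : ℕ
    adj  : Fin size → Fin size → Bool
open Graph public

V : Graph → Set
V G = Fin (size G)

record IsSimple (G : Graph) : Set where
  field
    adj-sym : ∀ x y → adj G x y ≡ adj G y x
    adj-irr : ∀ x → adj G x x ≡ false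

Nonempty : Graph → Set
Nonempty G = 0 < size G

Class : Set₁
Class = Graph → Set

_≅_ : Graph → Graph → Set
G ≅ H = Σ (V G ⤖ V H) λ f →
          ∀ x y → adj G x y ≡ adj H (Bijection.to f x) (Bijection.to f y)

-- Monadic second-order logic over ⌊G⌋ = ⟨V, edg⟩.
-- Formula m k : formulas with first-order variables among Fin m and
-- set (monadic second-order) variables among Fin k (de Bruijn style).

data Formula (m k : ℕ) : Set where
  edg  : Fin m → Fin m → Formula m k
  eq   : Fin m → Fin m → Formula m k
  mem  : Fin m → Fin k → Formula m k
  neg  : Formula m k → Formula m k
  conj : Formula m k → Formula m k → Formula m k
  disj : Formula m k → Formula m k → Formula m k
  ex₁  : Formula (suc m) k → Formula m k
  ex₂  : Formula m (suc k) → Formula m k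

VSet : Graph → Set
VSet G = V G → Bool

Sat : ∀ {m k} (G : Graph) → (Fin m → V G) → (Fin k → VSet G) → Formula m k → Set
Sat G ρ σ (edg x y)    = T (adj G (ρ x) (ρ y))
Sat G ρ σ (eq x y)     = ρ x ≡ ρ y
Sat G ρ σ (mem x Z)    = T (σ Z (ρ x))
Sat G ρ σ (neg φ)      = ¬ Sat G ρ σ φ
Sat G ρ σ (conj φ ψ)   = Sat G ρ σ φ × Sat G ρ σ ψ
Sat G ρ σ (disj φ ψ)   = Sat G ρ σ φ ⊎ Sat G ρ σ ψ
Sat G ρ σ (ex₁ φ)      = ∃[ a ] Sat G (a ∷ ρ) σ φ
Sat G ρ σ (ex₂ φ)      = ∃[ P ] Sat G ρ (P ∷ σ) φ

Rel[_,_,_] : ∀ {ℓ} (G : Graph) → Formula 2 ℓ → (Fin ℓ → VSet G) → V G → V G → Set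
Rel[ G , φ , P ] a b = Sat G (a ∷ (b ∷ λ ())) P φ

MSO₁-orderable : Class → Set
MSO₁-orderable C =
  ∃[ ℓ ] ∃[ φ ] ∀ G → C G → Nonempty G →
    ∃[ P ] IsTotalOrder _≡_ (Rel[_,_,_] {ℓ} G φ P)

record PortGraph (k : ℕ) : Set where
  field
    graph : Graph
    port  : V graph → Fin k
open PortGraph public

PortRel : ℕ → Set
PortRel k = Fin k → Fin k → Bool

-- G ⊗_R H: disjoint union (vertices of G first, then H) plus all edges
-- {x,y} with x in one graph, y in the other, and (port x, port y) ∈ R
-- (for an unordered edge either orientation may witness membership in R).
_⊗[_]_ : ∀ {k} → PortGraph k → PortRel k → PortGraph k → PortGraph k
_⊗[_]_ {k} G R H = record { graph = record { size = n ; adj = A } ; port = p }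
  where
  n = size (graph G) + size (graph H)
  cross : Fin k → Fin k → Bool
  cross i j = R i j ∨ R j i
  A : Fin n → Fin n → Bool
  A x y with splitAt (size (graph G)) x | splitAt (size (graph G)) y
  ... | inj₁ a | inj₁ b = adj (graph G) a b
  ... | inj₂ a | inj₂ b = adj (graph H) a b
  ... | inj₁ a | inj₂ b = cross (port G a) (port H b)
  ... | inj₂ a | inj₁ b = cross (port H a) (port G b)
  p : Fin n → Fin k
  p x with splitAt (size (graph G)) x
  ... | inj₁ a = port G a
  ... | inj₂ a = port H a

emptyPG : ∀ {k} → PortGraph k
emptyPG = record { graph = record { size = 0 ; adj = λ () } ; port = λ () }

-- H₀ ⊗_R H₁ ⊗_R ⋯ ⊗_R H_{n-1}  (⊗_R is associative up to isomorphism)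
⨂[_] : ∀ {k} → PortRel k → ∀ n → (Fin n → PortGraph k) → PortGraph k
⨂[ R ] zero    H = emptyPG
⨂[ R ] (suc n) H = H Data.Fin.zero ⊗[ R ] ⨂[ R ] n (λ i → H (Data.Fin.suc i))

Del : ∀ {k} → PortGraph k → Graph
Del = graph

HasCut : Graph → ℕ → ℕ → Set
HasCut G k n =
  ∃[ H ] ∃[ R ] ((∀ i → Nonempty (graph (H i)) × IsSimple (graph (H i)))
                 × (G ≅ Del (⨂[_] {k} R n H)))

-- Cut(G,k) ≤ b, where Cut(G,k) is the maximal n with HasCut G k n
Cut≤ : Graph → ℕ → ℕ → Set
Cut≤ G k b = ∀ n → HasCut G k n → n ≤ b

CUT : (ℕ → ℕ) → Class → Set
CUT f C = ∀ G → C G → ∀ k → Cut≤ G k (f k)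

exp : ℕ → ℕ → ℕ
exp zero    n = n
exp (suc j) n = 2 ^ exp j n

Elementary : (ℕ → ℕ) → Set
Elementary f = ∃[ j ] ∀ n → f n ≤ exp j n

-- Let φ(x, y; Z̄), of quantifier depth d with ℓ set parameters, define the
-- orders, and let G ≅ Del(H₀ ⊗_R ⋯ ⊗_R H_{n-1}) with ports in [k].  Colouring
-- vertices by their ports, G is the ⊗_R-sum of its pieces.  Each piece, with the
-- order parameters restricted to it, has a rank-(d+1) type, and there are at
-- most numTypes k (d+1) 0 ℓ types, an elementary function of k.  If n were
-- larger, two pieces i ≠ j would share a type; by the composition lemma for
-- sums, exchanging a vertex of piece i with its counterpart in piece j is
-- invisible to depth-d formulas, so φ would order the two vertices both ways.
module Submission where

open import Defs
open import Data.Nat using (ℕ; zero; suc; _+_; _*_; _^_; _≤_; _<_; z≤n; s≤s; _⊔_; _≤?_)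
open import Data.Fin using (Fin; zero; suc; splitAt; _↑ˡ_; _↑ʳ_; combine; funToFin; finToFun; fromℕ<)
open import Data.Fin.Subset using (Subset)
open import Data.Fin.Subset.Properties using (anySubset?)
open import Data.Vec using (lookup; tabulate)
open import Data.Vec.Properties using (lookup∘tabulate)
open import Data.Maybe as Maybe using (Maybe; just; nothing; _>>=_)
open import Data.Bool using (Bool; true; false; T; _∨_)
open import Data.Unit using (⊤; tt)
open import Data.Empty using (⊥; ⊥-elim)
open import Data.Product using (Σ; ∃; ∃-syntax; _×_; _,_; proj₁; proj₂; map₂)
open import Data.Sum using (inj₁; inj₂)
open import Data.Vec.Functional using (_∷_; [])
open import Function using (_∘_)
open import Function.Bundles using (_⇔_; mk⇔; Equivalence; Inverse; Bijection)
open import Function.Properties.Bijection using (⤖⇒↔)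
open import Relation.Binary.PropositionalEquality
open import Relation.Nullary using (¬_; yes; no; Dec; does; contradiction)
open import Relation.Binary.Structures using (IsTotalOrder)
open import Relation.Nullary.Decidable using (dec-true; dec-false)
open import Data.Fin.Properties using (_≟_; any?; pigeonhole; <⇒≢; combine-injective; finToFun-funToFin; suc-injective; splitAt-↑ˡ; splitAt-↑ʳ; splitAt⁻¹-↑ˡ; splitAt⁻¹-↑ʳ)
open import Data.Fin.Permutation as Perm using (Permutation′; _⟨$⟩ʳ_; _⟨$⟩ˡ_; inverseˡ; inverseʳ)
open import Data.Product.Function.NonDependent.Propositional using (_×-⇔_)
open import Data.Sum.Function.Propositional using (_⊎-⇔_)
open import Function.Related.TypeIsomorphisms using (¬-cong-⇔)
open import Data.Nat.Properties using (m⊔n≤o⇒m≤o; m⊔n≤o⇒n≤o; ≤-refl; ≤-trans; <⇒≤; +-mono-≤; +-mono-≤-<; *-mono-≤; *-monoʳ-≤; ^-monoʳ-≤; m^n>0; +-identityʳ; +-suc; m≤m⊔n; m≤n⊔m; ^-distribˡ-+-*; ≰⇒>; module ≤-Reasoning)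

-- Both a graph with ports and the ⊗_R-composition of a family of such
-- graphs are structures of this kind; the logic only sees edges and equality,
-- while the colours record the ports the composition depends on.
record Structure (k : ℕ) : Set₁ where
  field
    car : Set
    E   : car → car → Bool
    col : car → Fin k
open Structure

-- Pointwise equality of two-argument functions (assignments of set variables);
-- there is no function extensionality, so assignments are compared pointwise.
_≗₂_ : ∀ {X : Set} {ℓ} → (Fin ℓ → X → Bool) → (Fin ℓ → X → Bool) → Set
σ ≗₂ τ = ∀ Z a → σ Z a ≡ τ Z a

∷-cong : ∀ {X : Set} {m} {ρ₁ ρ₂ : Fin m → X} (u : X) → ρ₁ ≗ ρ₂ → (u ∷ ρ₁) ≗ (u ∷ ρ₂)
∷-cong u e zero    = refl
∷-cong u e (suc x) = e x

∷-cong₂ : ∀ {X : Set} {ℓ} {σ τ : Fin ℓ → X → Bool} (P : X → Bool) → σ ≗₂ τ → (P ∷ σ) ≗₂ (P ∷ τ)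
∷-cong₂ P e zero    a = refl
∷-cong₂ P e (suc Z) a = e Z a

rename : ∀ {X : Set} {m m'} → (Fin m' → Maybe (Fin m)) → (Fin m → Maybe X) → Fin m' → Maybe X
rename r ρ x = r x >>= ρ

liftRenaming : ∀ {m m'} → (Fin m' → Maybe (Fin m)) → Fin (suc m') → Maybe (Fin (suc m))
liftRenaming r zero    = just zero
liftRenaming r (suc x) = Maybe.map suc (r x)

rename-lift : ∀ {X : Set} {m m'} (r : Fin m' → Maybe (Fin m)) (u : Maybe X) (ρ : Fin m → Maybe X) →
  rename (liftRenaming r) (u ∷ ρ) ≗ (u ∷ rename r ρ)
rename-lift r u ρ zero = refl
rename-lift r u ρ (suc x) with r x
... | nothing = refl
... | just y  = refl

skip : ∀ {m} → Fin (suc m) → Maybe (Fin m)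
skip zero    = nothing
skip (suc x) = just x

rename-skip : ∀ {X : Set} {m} (ρ : Fin m → Maybe X) → rename skip ρ ≗ (nothing ∷ ρ)
rename-skip ρ zero    = refl
rename-skip ρ (suc x) = refl

module _ {k : ℕ} where

  -- Partial assignments of m first-order variables (a variable may be
  -- undefined: restricting an assignment on a composed structure to one piece
  -- leaves the variables pointing into other pieces undefined) and total
  -- assignments of ℓ set variables.
  Asg : Structure k → ℕ → Set
  Asg A m = Fin m → Maybe (car A)

  Sets : Structure k → ℕ → Set
  Sets A ℓ = Fin ℓ → car A → Bool

  SameVertex : (A B : Structure k) {ℓ : ℕ} → Sets A ℓ → Sets B ℓ →
               Maybe (car A) → Maybe (car B) → Set
  SameVertex A B σ σ' nothing  nothing  = ⊤
  SameVertex A B σ σ' nothing  (just _) = ⊥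
  SameVertex A B σ σ' (just _) nothing  = ⊥
  SameVertex A B σ σ' (just a) (just b) = (col A a ≡ col B b) × (∀ Z → σ Z a ≡ σ' Z b)

  SameEdge : (A B : Structure k) → car A → car A → car B → car B → Set
  SameEdge A B a b a' b' = (E A a b ≡ E B a' b') × (a ≡ b → a' ≡ b') × (a' ≡ b' → a ≡ b)

  SamePair : (A B : Structure k) → Maybe (car A) → Maybe (car A) → Maybe (car B) → Maybe (car B) → Set
  SamePair A B u v u' v' = ∀ {a b a' b'} → u ≡ just a → v ≡ just b → u' ≡ just a' → v' ≡ just b' →
                           SameEdge A B a b a' b'

  SameAtoms : (A B : Structure k) {m ℓ : ℕ} → Asg A m → Sets A ℓ → Asg B m → Sets B ℓ → Set
  SameAtoms A B ρ σ ρ' σ' =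
    (∀ x → SameVertex A B σ σ' (ρ x) (ρ' x)) × (∀ x y → SamePair A B (ρ x) (ρ y) (ρ' x) (ρ' y))

  EF : ℕ → (A B : Structure k) {m ℓ : ℕ} → Asg A m → Sets A ℓ → Asg B m → Sets B ℓ → Set
  EF zero    A B ρ σ ρ' σ' = SameAtoms A B ρ σ ρ' σ'
  EF (suc q) A B ρ σ ρ' σ' = SameAtoms A B ρ σ ρ' σ' ×
    ((∀ a → ∃[ b ] EF q A B (just a ∷ ρ) σ (just b ∷ ρ') σ') ×
     (∀ b → ∃[ a ] EF q A B (just a ∷ ρ) σ (just b ∷ ρ') σ') ×
     (∀ P → ∃[ P' ] EF q A B ρ (P ∷ σ) ρ' (P' ∷ σ')) ×
     (∀ P' → ∃[ P ] EF q A B ρ (P ∷ σ) ρ' (P' ∷ σ')))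

  EF⇒SameAtoms : ∀ q {A B m ℓ} {ρ : Asg A m} {σ : Sets A ℓ} {ρ' : Asg B m} {σ' : Sets B ℓ} →
    EF q A B ρ σ ρ' σ' → SameAtoms A B ρ σ ρ' σ'
  EF⇒SameAtoms zero    e = e
  EF⇒SameAtoms (suc q) e = proj₁ e

  EF-suc⇒EF : ∀ q {A B m ℓ} {ρ : Asg A m} {σ : Sets A ℓ} {ρ' : Asg B m} {σ' : Sets B ℓ} →
    EF (suc q) A B ρ σ ρ' σ' → EF q A B ρ σ ρ' σ'
  EF-suc⇒EF zero    e = proj₁ e
  EF-suc⇒EF (suc q) (at , f , b , fs , bs) =
    at , (λ a → map₂ (EF-suc⇒EF q) (f a)) , (λ c → map₂ (EF-suc⇒EF q) (b c)) ,
         (λ P → map₂ (EF-suc⇒EF q) (fs P)) , (λ P → map₂ (EF-suc⇒EF q) (bs P))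

  SameVertex-cong : ∀ {A B ℓ} {σ₁ σ₂ : Sets A ℓ} {σ₁' σ₂' : Sets B ℓ} → σ₁ ≗₂ σ₂ → σ₁' ≗₂ σ₂' →
    ∀ u v → SameVertex A B σ₁ σ₁' u v → SameVertex A B σ₂ σ₂' u v
  SameVertex-cong e e' nothing  nothing  r       = r
  SameVertex-cong e e' (just a) (just b) (c , s) = c , λ Z → trans (sym (e Z a)) (trans (s Z) (e' Z b))

  SameAtoms-cong : ∀ {A B m ℓ} {ρ₁ ρ₂ : Asg A m} {σ₁ σ₂ : Sets A ℓ} {ρ₁' ρ₂' : Asg B m} {σ₁' σ₂' : Sets B ℓ} →
    ρ₁ ≗ ρ₂ → σ₁ ≗₂ σ₂ → ρ₁' ≗ ρ₂' → σ₁' ≗₂ σ₂' →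
    SameAtoms A B ρ₁ σ₁ ρ₁' σ₁' → SameAtoms A B ρ₂ σ₂ ρ₂' σ₂'
  SameAtoms-cong {A} {B} {ρ₂ = ρ₂} {σ₁ = σ₁} {ρ₂' = ρ₂'} {σ₁'} eρ eσ eρ' eσ' (vs , ps) =
    (λ x → SameVertex-cong eσ eσ' (ρ₂ x) (ρ₂' x) (subst₂ (SameVertex A B σ₁ σ₁') (eρ x) (eρ' x) (vs x))) ,
    λ x y ea eb ea' eb' → ps x y (trans (eρ x) ea) (trans (eρ y) eb) (trans (eρ' x) ea') (trans (eρ' y) eb')

  EF-cong : ∀ q {A B m ℓ} {ρ₁ ρ₂ : Asg A m} {σ₁ σ₂ : Sets A ℓ} {ρ₁' ρ₂' : Asg B m} {σ₁' σ₂' : Sets B ℓ} →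
    ρ₁ ≗ ρ₂ → σ₁ ≗₂ σ₂ → ρ₁' ≗ ρ₂' → σ₁' ≗₂ σ₂' →
    EF q A B ρ₁ σ₁ ρ₁' σ₁' → EF q A B ρ₂ σ₂ ρ₂' σ₂'
  EF-cong zero    eρ eσ eρ' eσ' e = SameAtoms-cong eρ eσ eρ' eσ' e
  EF-cong (suc q) eρ eσ eρ' eσ' (at , f , b , fs , bs) =
    SameAtoms-cong eρ eσ eρ' eσ' at ,
    (λ a → map₂ (λ {b} → EF-cong q (∷-cong (just a) eρ) eσ (∷-cong (just b) eρ') eσ') (f a)) ,
    (λ c → map₂ (λ {a} → EF-cong q (∷-cong (just a) eρ) eσ (∷-cong (just c) eρ') eσ') (b c)) ,
    (λ P → map₂ (λ {P'} → EF-cong q eρ (∷-cong₂ P eσ) eρ' (∷-cong₂ P' eσ')) (fs P)) ,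
    (λ P' → map₂ (λ {P} → EF-cong q eρ (∷-cong₂ P eσ) eρ' (∷-cong₂ P' eσ')) (bs P'))

  SameVertex-refl : ∀ {A ℓ} (σ : Sets A ℓ) u → SameVertex A A σ σ u u
  SameVertex-refl σ nothing  = tt
  SameVertex-refl σ (just a) = refl , λ Z → refl

  SamePair-refl : ∀ {A} u v → SamePair A A u v u v
  SamePair-refl u v refl refl refl refl = refl , (λ e → e) , (λ e → e)

  EF-refl : ∀ q {A m ℓ} (ρ : Asg A m) (σ : Sets A ℓ) → EF q A A ρ σ ρ σ
  EF-refl zero {A} ρ σ = (λ x → SameVertex-refl σ (ρ x)) , λ x y → SamePair-refl {A} (ρ x) (ρ y)
  EF-refl (suc q) ρ σ = EF-refl zero ρ σ ,
    (λ a → a , EF-refl q _ σ) , (λ a → a , EF-refl q _ σ) ,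
    (λ P → P , EF-refl q ρ _) , (λ P → P , EF-refl q ρ _)

  SameVertex-sym : ∀ {A B ℓ} {σ : Sets A ℓ} {σ' : Sets B ℓ} u v →
    SameVertex A B σ σ' u v → SameVertex B A σ' σ v u
  SameVertex-sym nothing  nothing  r       = tt
  SameVertex-sym (just a) (just b) (c , s) = sym c , λ Z → sym (s Z)

  SamePair-sym : ∀ {A B u v u' v'} → SamePair A B u v u' v' → SamePair B A u' v' u v
  SamePair-sym r ea eb ea' eb' with r ea' eb' ea eb
  ... | e , f , g = sym e , g , f

  EF-sym : ∀ q {A B m ℓ} {ρ : Asg A m} {σ : Sets A ℓ} {ρ' : Asg B m} {σ' : Sets B ℓ} →
    EF q A B ρ σ ρ' σ' → EF q B A ρ' σ' ρ σ
  EF-sym zero {A} {B} {ρ = ρ} {ρ' = ρ'} (vs , ps) =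
    (λ x → SameVertex-sym (ρ x) (ρ' x) (vs x)) , λ x y → SamePair-sym {A} {B} (ps x y)
  EF-sym (suc q) (at , f , b , fs , bs) =
    EF-sym zero at ,
    (λ c → map₂ (EF-sym q) (b c)) , (λ a → map₂ (EF-sym q) (f a)) ,
    (λ P → map₂ (EF-sym q) (bs P)) , (λ P → map₂ (EF-sym q) (fs P))

  SameVertex-defined : ∀ {A B ℓ} {σ : Sets A ℓ} {σ' : Sets B ℓ} {u a} u' →
    SameVertex A B σ σ' u u' → u ≡ just a → ∃[ a' ] u' ≡ just a'
  SameVertex-defined (just a') r refl = a' , refl
  SameVertex-defined nothing   r refl = ⊥-elim r

  SameVertex-trans : ∀ {A B C ℓ} {σ : Sets A ℓ} {σ' : Sets B ℓ} {σ'' : Sets C ℓ} u v w →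
    SameVertex A B σ σ' u v → SameVertex B C σ' σ'' v w → SameVertex A C σ σ'' u w
  SameVertex-trans nothing  nothing  nothing  r s = tt
  SameVertex-trans (just a) (just b) (just c) (c1 , s1) (c2 , s2) = trans c1 c2 , λ Z → trans (s1 Z) (s2 Z)

  SamePair-trans : ∀ {A B C ℓ} {σ : Sets A ℓ} {σ' : Sets B ℓ} {u v u' v' u'' v''} →
    SameVertex A B σ σ' u u' → SameVertex A B σ σ' v v' →
    SamePair A B u v u' v' → SamePair B C u' v' u'' v'' → SamePair A C u v u'' v''
  SamePair-trans {u' = u'} {v'} ru rv r s ea eb ea'' eb''
    with SameVertex-defined u' ru ea | SameVertex-defined v' rv eb
  ... | a' , ea' | b' , eb' with r ea eb ea' eb' | s ea' eb' ea'' eb''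
  ... | e₁ , f₁ , g₁ | e₂ , f₂ , g₂ = trans e₁ e₂ , f₂ ∘ f₁ , g₁ ∘ g₂

  EF-trans : ∀ q {A B C m ℓ} {ρ : Asg A m} {σ : Sets A ℓ} {ρ' : Asg B m} {σ' : Sets B ℓ}
    {ρ'' : Asg C m} {σ'' : Sets C ℓ} →
    EF q A B ρ σ ρ' σ' → EF q B C ρ' σ' ρ'' σ'' → EF q A C ρ σ ρ'' σ''
  EF-trans zero {A} {B} {C} {ρ = ρ} {ρ' = ρ'} {ρ'' = ρ''} (vs , ps) (vs' , ps') =
    (λ x → SameVertex-trans (ρ x) (ρ' x) (ρ'' x) (vs x) (vs' x)) ,
    λ x y → SamePair-trans {A} {B} {C} (vs x) (vs y) (ps x y) (ps' x y)
  EF-trans (suc q) (at , f , b , fs , bs) (at' , f' , b' , fs' , bs') =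
    EF-trans zero at at' ,
    (λ a → let (a' , e) = f a in map₂ (EF-trans q e) (f' a')) ,
    (λ c → let (c' , e) = b' c in map₂ (λ e' → EF-trans q e' e) (b c')) ,
    (λ P → let (P' , e) = fs P in map₂ (EF-trans q e) (fs' P')) ,
    (λ P → let (P' , e) = bs' P in map₂ (λ e' → EF-trans q e' e) (bs P'))

  SameAtoms-rename : ∀ {A B m m' ℓ} (r : Fin m' → Maybe (Fin m)) {ρ : Asg A m} {σ : Sets A ℓ}
    {ρ' : Asg B m} {σ' : Sets B ℓ} →
    SameAtoms A B ρ σ ρ' σ' → SameAtoms A B (rename r ρ) σ (rename r ρ') σ'
  SameAtoms-rename {A} {B} r {ρ} {σ} {ρ'} {σ'} (vs , ps) = vertices , pairs
    where
    vertices : ∀ x → SameVertex A B σ σ' (rename r ρ x) (rename r ρ' x)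
    vertices x with r x
    ... | nothing = tt
    ... | just y  = vs y
    pairs : ∀ x y → SamePair A B (rename r ρ x) (rename r ρ y) (rename r ρ' x) (rename r ρ' y)
    pairs x y ea eb ea' eb' with r x | r y
    pairs x y () eb ea' eb' | nothing | _
    pairs x y ea () ea' eb' | just _  | nothing
    pairs x y ea eb ea' eb' | just x' | just y' = ps x' y' ea eb ea' eb'

  EF-rename : ∀ q {A B m m' ℓ} (r : Fin m' → Maybe (Fin m)) {ρ : Asg A m} {σ : Sets A ℓ}
    {ρ' : Asg B m} {σ' : Sets B ℓ} →
    EF q A B ρ σ ρ' σ' → EF q A B (rename r ρ) σ (rename r ρ') σ'
  EF-rename zero    r e = SameAtoms-rename r e
  EF-rename (suc q) {A} {B} {ℓ = ℓ} r {ρ} {ρ' = ρ'} (at , f , b , fs , bs) =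
    SameAtoms-rename r at ,
    (λ a → map₂ (λ {a'} → moved (just a) (just a')) (f a)) ,
    (λ c → map₂ (λ {c'} → moved (just c') (just c)) (b c)) ,
    (λ P → map₂ (EF-rename q r) (fs P)) ,
    (λ P → map₂ (EF-rename q r) (bs P))
    where
    moved : ∀ u u' {σ : Sets A ℓ} {σ' : Sets B ℓ} →
      EF q A B (u ∷ ρ) σ (u' ∷ ρ') σ' → EF q A B (u ∷ rename r ρ) σ (u' ∷ rename r ρ') σ'
    moved u u' e = EF-cong q (rename-lift r u ρ) (λ _ _ → refl) (rename-lift r u' ρ') (λ _ _ → refl)
                     (EF-rename q (liftRenaming r) e)

  EF-undefined : ∀ q {A B m ℓ} {ρ : Asg A m} {σ : Sets A ℓ} {ρ' : Asg B m} {σ' : Sets B ℓ} →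
    EF q A B ρ σ ρ' σ' → EF q A B (nothing ∷ ρ) σ (nothing ∷ ρ') σ'
  EF-undefined q {ρ = ρ} {ρ' = ρ'} e =
    EF-cong q (rename-skip ρ) (λ _ _ → refl) (rename-skip ρ') (λ _ _ → refl) (EF-rename q skip e)

  record _≃_ (A B : Structure k) : Set where
    field
      to      : car A → car B
      from    : car B → car A
      to-from : ∀ b → to (from b) ≡ b
      from-to : ∀ a → from (to a) ≡ a
      edge    : ∀ a a' → E A a a' ≡ E B (to a) (to a')
      colour  : ∀ a → col A a ≡ col B (to a)

    to-injective : ∀ {a a'} → to a ≡ to a' → a ≡ a'
    to-injective {a} {a'} e = trans (sym (from-to a)) (trans (cong from e) (from-to a'))

  module _ {A B : Structure k} (iso : A ≃ B) where
    open _≃_ iso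

    iso-SamePair : ∀ {u v u' v'} → u' ≡ Maybe.map to u → v' ≡ Maybe.map to v → SamePair A B u v u' v'
    iso-SamePair refl refl refl refl refl refl = edge _ _ , cong to , to-injective

    iso-SameVertex : ∀ {ℓ} {σ : Sets A ℓ} {σ' : Sets B ℓ} → (∀ Z a → σ' Z (to a) ≡ σ Z a) →
      ∀ u → SameVertex A B σ σ' u (Maybe.map to u)
    iso-SameVertex eσ nothing  = tt
    iso-SameVertex eσ (just a) = colour a , λ Z → sym (eσ Z a)

    EF-iso : ∀ q {m ℓ} (ρ : Asg A m) (σ : Sets A ℓ) (ρ' : Asg B m) (σ' : Sets B ℓ) →
      ρ' ≗ Maybe.map to ∘ ρ → (∀ Z a → σ' Z (to a) ≡ σ Z a) → EF q A B ρ σ ρ' σ'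
    EF-iso zero ρ σ ρ' σ' eρ eσ =
      (λ x → subst (SameVertex A B σ σ' (ρ x)) (sym (eρ x)) (iso-SameVertex eσ (ρ x))) ,
      λ x y → iso-SamePair (eρ x) (eρ y)
    EF-iso (suc q) ρ σ ρ' σ' eρ eσ =
      EF-iso zero ρ σ ρ' σ' eρ eσ ,
      (λ a → to a , EF-iso q _ σ _ σ' (extend (just a) (just (to a)) refl) eσ) ,
      (λ b → from b , EF-iso q _ σ _ σ' (extend (just (from b)) (just b) (cong just (sym (to-from b)))) eσ) ,
      (λ P → P ∘ from , EF-iso q ρ _ ρ' _ eρ (extendSets P (P ∘ from) (λ a → cong P (from-to a)))) ,
      (λ P' → P' ∘ to , EF-iso q ρ _ ρ' _ eρ (extendSets (P' ∘ to) P' (λ a → refl)))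
      where
      extend : ∀ u u' → u' ≡ Maybe.map to u → (u' ∷ ρ') ≗ Maybe.map to ∘ (u ∷ ρ)
      extend u u' e zero    = e
      extend u u' e (suc x) = eρ x
      extendSets : ∀ P P' → (∀ a → P' (to a) ≡ P a) → ∀ Z a → (P' ∷ σ') Z (to a) ≡ (P ∷ σ) Z a
      extendSets P P' e zero    a = e a
      extendSets P P' e (suc Z) a = eσ Z a

  graphStructure : (G : Graph) → (V G → Fin k) → Structure k
  graphStructure G c = record { car = V G ; E = adj G ; col = c }

depth : ∀ {m ℓ} → Formula m ℓ → ℕ
depth (edg x y)  = 0
depth (eq x y)   = 0
depth (mem x Z)  = 0
depth (neg φ)    = depth φ
depth (conj φ ψ) = depth φ ⊔ depth ψ
depth (disj φ ψ) = depth φ ⊔ depth ψ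
depth (ex₁ φ)    = suc (depth φ)
depth (ex₂ φ)    = suc (depth φ)

T-cong : ∀ {a b : Bool} → a ≡ b → T a ⇔ T b
T-cong refl = mk⇔ (λ t → t) (λ t → t)

just-∷ : ∀ {X : Set} {m} (a : X) (ρ : Fin m → X) → (just a ∷ just ∘ ρ) ≗ just ∘ (a ∷ ρ)
just-∷ a ρ zero    = refl
just-∷ a ρ (suc x) = refl

EF⇒Sat : ∀ {k} q {m ℓ} (φ : Formula m ℓ) → depth φ ≤ q → ∀ {G G' : Graph} {c : V G → Fin k} {c'}
  (ρ : Fin m → V G) σ (ρ' : Fin m → V G') σ' →
  EF q (graphStructure G c) (graphStructure G' c') (just ∘ ρ) σ (just ∘ ρ') σ' →
  Sat G ρ σ φ ⇔ Sat G' ρ' σ' φ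
EF⇒Sat q (edg x y) d ρ σ ρ' σ' e = T-cong (proj₁ (proj₂ (EF⇒SameAtoms q e) x y refl refl refl refl))
EF⇒Sat q (eq x y)  d ρ σ ρ' σ' e =
  let _ , f , g = proj₂ (EF⇒SameAtoms q e) x y refl refl refl refl in mk⇔ f g
EF⇒Sat q (mem x Z) d ρ σ ρ' σ' e = T-cong (proj₂ (proj₁ (EF⇒SameAtoms q e) x) Z)
EF⇒Sat q (neg φ)   d ρ σ ρ' σ' e = ¬-cong-⇔ (EF⇒Sat q φ d ρ σ ρ' σ' e)
EF⇒Sat q (conj φ ψ) d ρ σ ρ' σ' e =
  EF⇒Sat q φ (m⊔n≤o⇒m≤o (depth φ) (depth ψ) d) ρ σ ρ' σ' e ×-⇔
  EF⇒Sat q ψ (m⊔n≤o⇒n≤o (depth φ) (depth ψ) d) ρ σ ρ' σ' e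
EF⇒Sat q (disj φ ψ) d ρ σ ρ' σ' e =
  EF⇒Sat q φ (m⊔n≤o⇒m≤o (depth φ) (depth ψ) d) ρ σ ρ' σ' e ⊎-⇔
  EF⇒Sat q ψ (m⊔n≤o⇒n≤o (depth φ) (depth ψ) d) ρ σ ρ' σ' e
EF⇒Sat (suc q) (ex₁ φ) (s≤s d) {G} {G'} {c} {c'} ρ σ ρ' σ' (_ , f , b , _ , _) =
  mk⇔ (λ (a , s) → let (a' , e) = f a in a' , Equivalence.to (moved a a' e) s)
      (λ (a' , s) → let (a , e) = b a' in a , Equivalence.from (moved a a' e) s)
  where
  moved : ∀ a a' → EF q (graphStructure G c) (graphStructure G' c') (just a ∷ just ∘ ρ) σ (just a' ∷ just ∘ ρ') σ' →
          Sat G (a ∷ ρ) σ φ ⇔ Sat G' (a' ∷ ρ') σ' φ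
  moved a a' e = EF⇒Sat q φ d (a ∷ ρ) σ (a' ∷ ρ') σ'
                   (EF-cong q (just-∷ a ρ) (λ _ _ → refl) (just-∷ a' ρ') (λ _ _ → refl) e)
EF⇒Sat (suc q) (ex₂ φ) (s≤s d) ρ σ ρ' σ' (_ , _ , _ , fs , bs) =
  mk⇔ (λ (P , s) → let (P' , e) = fs P in P' , Equivalence.to (EF⇒Sat q φ d ρ (P ∷ σ) ρ' (P' ∷ σ') e) s)
      (λ (P' , s) → let (P , e) = bs P' in P , Equivalence.from (EF⇒Sat q φ d ρ (P ∷ σ) ρ' (P' ∷ σ') e) s)

module Sum {k n : ℕ} (R : PortRel k) where

  cross : Fin k → Fin k → Bool
  cross i j = R i j ∨ R j i

  SumCar : (Fin n → Structure k) → Set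
  SumCar H = Σ (Fin n) (car ∘ H)

  sumEdge : (H : Fin n → Structure k) → SumCar H → SumCar H → Bool
  sumEdge H (i , v) (j , w) with i ≟ j
  ... | yes refl = E (H i) v w
  ... | no _     = cross (col (H i) v) (col (H j) w)

  ⨁ : (Fin n → Structure k) → Structure k
  ⨁ H = record { car = SumCar H ; E = sumEdge H ; col = λ (i , v) → col (H i) v }

  sumEdge-same : ∀ H i a b → sumEdge H (i , a) (i , b) ≡ E (H i) a b
  sumEdge-same H i a b with i ≟ i
  ... | yes refl = refl
  ... | no i≢i   = ⊥-elim (i≢i refl)

  sumEdge-other : ∀ H i j a b → ¬ i ≡ j → sumEdge H (i , a) (j , b) ≡ cross (col (H i) a) (col (H j) b)
  sumEdge-other H i j a b i≢j with i ≟ j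
  ... | yes refl = ⊥-elim (i≢j refl)
  ... | no _     = refl

  restrict : (H : Fin n → Structure k) (i : Fin n) → Maybe (SumCar H) → Maybe (car (H i))
  restrict H i nothing = nothing
  restrict H i (just (j , w)) with j ≟ i
  ... | yes refl = just w
  ... | no _     = nothing

  restrictSets : ∀ {ℓ} (H : Fin n → Structure k) i → Sets (⨁ H) ℓ → Sets (H i) ℓ
  restrictSets H i σ Z v = σ Z (i , v)

  restrict-same : ∀ H i v → restrict H i (just (i , v)) ≡ just v
  restrict-same H i v with i ≟ i
  ... | yes refl = refl
  ... | no i≢i   = ⊥-elim (i≢i refl)

  restrict-other : ∀ H i j w → ¬ j ≡ i → restrict H i (just (j , w)) ≡ nothing
  restrict-other H i j w j≢i with j ≟ i
  ... | yes refl = ⊥-elim (j≢i refl)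
  ... | no _     = refl

  PiecewiseEF : Permutation′ n → (H H' : Fin n → Structure k) → ℕ → ∀ {m ℓ} →
    Asg (⨁ H) m → Sets (⨁ H) ℓ → Asg (⨁ H') m → Sets (⨁ H') ℓ → Set
  PiecewiseEF π H H' q ρ σ ρ' σ' =
    ∀ i → EF q (H i) (H' (π ⟨$⟩ʳ i)) (restrict H i ∘ ρ) (restrictSets H i σ)
                                     (restrict H' (π ⟨$⟩ʳ i) ∘ ρ') (restrictSets H' (π ⟨$⟩ʳ i) σ')

  module _ (π : Permutation′ n) (H H' : Fin n → Structure k) where

    π⟨_⟩ : Fin n → Fin n
    π⟨ i ⟩ = π ⟨$⟩ʳ i

    π-injective : ∀ {i j} → π⟨ i ⟩ ≡ π⟨ j ⟩ → i ≡ j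
    π-injective {i} {j} e = trans (sym (inverseˡ π)) (trans (cong (π ⟨$⟩ˡ_) e) (inverseˡ π))

    data Matched {ℓ} (σ : Sets (⨁ H) ℓ) (σ' : Sets (⨁ H') ℓ) : Maybe (SumCar H) → Maybe (SumCar H') → Set where
      undefined : Matched σ σ' nothing nothing
      inPiece   : ∀ i a a' → SameVertex (H i) (H' π⟨ i ⟩) (restrictSets H i σ) (restrictSets H' π⟨ i ⟩ σ') (just a) (just a') →
                  Matched σ σ' (just (i , a)) (just (π⟨ i ⟩ , a'))

    private
      undefined-in-piece : ∀ {ℓ} {σ : Sets (⨁ H) ℓ} {σ' : Sets (⨁ H') ℓ} i j w t → t ≡ j →
        ¬ SameVertex (H i) (H' t) (restrictSets H i σ) (restrictSets H' t σ') nothing (restrict H' t (just (j , w)))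
      undefined-in-piece {σ = σ} {σ'} i j w .j refl r =
        subst (SameVertex (H i) (H' j) (restrictSets H i σ) (restrictSets H' j σ') nothing) (restrict-same H' j w) r

      defined-in-piece : ∀ {ℓ} {σ : Sets (⨁ H) ℓ} {σ' : Sets (⨁ H') ℓ} i a u' →
        SameVertex (H i) (H' π⟨ i ⟩) (restrictSets H i σ) (restrictSets H' π⟨ i ⟩ σ') (just a) (restrict H' π⟨ i ⟩ u') →
        Matched σ σ' (just (i , a)) u'
      defined-in-piece i a nothing r = ⊥-elim r
      defined-in-piece i a (just (j , w)) r with j ≟ π⟨ i ⟩
      ... | yes refl = inPiece i a w r
      ... | no _     = ⊥-elim r

    match : ∀ {ℓ} {σ : Sets (⨁ H) ℓ} {σ' : Sets (⨁ H') ℓ} u u' →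
      (∀ i → SameVertex (H i) (H' π⟨ i ⟩) (restrictSets H i σ) (restrictSets H' π⟨ i ⟩ σ') (restrict H i u) (restrict H' π⟨ i ⟩ u')) →
      Matched σ σ' u u'
    match nothing nothing _ = undefined
    match {σ = σ} {σ'} nothing (just (j , w)) hyp =
      ⊥-elim (undefined-in-piece {σ = σ} {σ'} (π ⟨$⟩ˡ j) j w π⟨ π ⟨$⟩ˡ j ⟩ (inverseʳ π) (hyp (π ⟨$⟩ˡ j)))
    match {σ = σ} {σ'} (just (i , a)) u' hyp =
      defined-in-piece i a u'
        (subst (λ z → SameVertex (H i) (H' π⟨ i ⟩) (restrictSets H i σ) (restrictSets H' π⟨ i ⟩ σ') z (restrict H' π⟨ i ⟩ u'))
               (restrict-same H i a) (hyp i))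

    Matched⇒SameVertex : ∀ {ℓ} {σ : Sets (⨁ H) ℓ} {σ' : Sets (⨁ H') ℓ} {u u'} →
      Matched σ σ' u u' → SameVertex (⨁ H) (⨁ H') σ σ' u u'
    Matched⇒SameVertex undefined              = tt
    Matched⇒SameVertex (inPiece i a a' (c , s)) = c , s

    private
      Σ-injectiveʳ : ∀ {X : Fin n → Set} {t} {x y : X t} → _≡_ {A = Σ (Fin n) X} (t , x) (t , y) → x ≡ y
      Σ-injectiveʳ refl = refl

    -- Within one piece the sum looks like the piece; across pieces only the
    -- colours matter, and these agree for matched vertices.  (Abstracting over
    -- i ≟ j also evaluates the edge of the left-hand sum in each case.)
    Matched⇒SamePair : ∀ {ℓ} {σ : Sets (⨁ H) ℓ} {σ' : Sets (⨁ H') ℓ} {u v u' v'} →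
      Matched σ σ' u u' → Matched σ σ' v v' →
      (∀ i → SamePair (H i) (H' π⟨ i ⟩) (restrict H i u) (restrict H i v) (restrict H' π⟨ i ⟩ u') (restrict H' π⟨ i ⟩ v')) →
      SamePair (⨁ H) (⨁ H') u v u' v'
    Matched⇒SamePair (inPiece i a a' (ca , _)) (inPiece j b b' (cb , _)) hyp refl refl refl refl with i ≟ j
    ... | yes refl =
      let e , f , g = hyp i (restrict-same H i a) (restrict-same H i b)
                            (restrict-same H' π⟨ i ⟩ a') (restrict-same H' π⟨ i ⟩ b') in
      trans e (sym (sumEdge-same H' π⟨ i ⟩ a' b')) ,
      (λ p → cong (π⟨ i ⟩ ,_) (f (Σ-injectiveʳ p))) ,
      (λ p → cong (i ,_) (g (Σ-injectiveʳ p)))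
    ... | no i≢j =
      trans (cong₂ cross ca cb) (sym (sumEdge-other H' π⟨ i ⟩ π⟨ j ⟩ a' b' (i≢j ∘ π-injective))) ,
      (λ p → ⊥-elim (i≢j (cong proj₁ p))) ,
      (λ p → ⊥-elim (i≢j (π-injective (cong proj₁ p))))

    SameAtoms-sum : ∀ {m ℓ} (ρ : Asg (⨁ H) m) (σ : Sets (⨁ H) ℓ) (ρ' : Asg (⨁ H') m) (σ' : Sets (⨁ H') ℓ) →
      (∀ i → SameAtoms (H i) (H' π⟨ i ⟩) (restrict H i ∘ ρ) (restrictSets H i σ)
                                         (restrict H' π⟨ i ⟩ ∘ ρ') (restrictSets H' π⟨ i ⟩ σ')) →
      SameAtoms (⨁ H) (⨁ H') ρ σ ρ' σ'
    SameAtoms-sum ρ σ ρ' σ' hyp = (λ x → Matched⇒SameVertex (matched x)) ,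
                                   λ x y → Matched⇒SamePair (matched x) (matched y) (λ i → proj₂ (hyp i) x y)
      where
      matched : ∀ x → Matched σ σ' (ρ x) (ρ' x)
      matched x = match (ρ x) (ρ' x) (λ i → proj₁ (hyp i) x)

  restrict-∷ : ∀ {m} H i u {u₀} (ρ : Fin m → Maybe (SumCar H)) → restrict H i u ≡ u₀ →
    (u₀ ∷ restrict H i ∘ ρ) ≗ restrict H i ∘ (u ∷ ρ)
  restrict-∷ H i u ρ e zero    = sym e
  restrict-∷ H i u ρ e (suc x) = refl

  PiecewiseEF-flip : ∀ q π H H' {m ℓ} {ρ : Asg (⨁ H) m} {σ : Sets (⨁ H) ℓ} {ρ' : Asg (⨁ H') m} {σ' : Sets (⨁ H') ℓ} →
    PiecewiseEF π H H' q ρ σ ρ' σ' → PiecewiseEF (Perm.flip π) H' H q ρ' σ' ρ σ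
  PiecewiseEF-flip q π H H' {ρ = ρ} {σ} {ρ'} {σ'} hyp j =
    subst (λ t → EF q (H' t) (H (π ⟨$⟩ˡ j)) (restrict H' t ∘ ρ') (restrictSets H' t σ')
                      (restrict H (π ⟨$⟩ˡ j) ∘ ρ) (restrictSets H (π ⟨$⟩ˡ j) σ))
          (inverseʳ π) (EF-sym q (hyp (π ⟨$⟩ˡ j)))

  mutual
    -- The composition lemma (Feferman–Vaught for ⊗_R-sums): if Duplicator wins
    -- q rounds on all pairs of corresponding pieces, she wins q rounds on the
    -- sums, by playing the piecewise strategies in parallel.
    EF-sum : ∀ q π H H' {m ℓ} (ρ : Asg (⨁ H) m) (σ : Sets (⨁ H) ℓ) (ρ' : Asg (⨁ H') m) (σ' : Sets (⨁ H') ℓ) →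
      PiecewiseEF π H H' q ρ σ ρ' σ' → EF q (⨁ H) (⨁ H') ρ σ ρ' σ'
    EF-sum zero π H H' ρ σ ρ' σ' hyp = SameAtoms-sum π H H' ρ σ ρ' σ' hyp
    EF-sum (suc q) π H H' ρ σ ρ' σ' hyp =
      SameAtoms-sum π H H' ρ σ ρ' σ' (λ i → proj₁ (hyp i)) ,
      answerVertex q π H H' ρ σ ρ' σ' hyp ,
      (λ b → map₂ (EF-sym q) (answerVertex q (Perm.flip π) H' H ρ' σ' ρ σ flipped b)) ,
      answerSet q π H H' ρ σ ρ' σ' hyp ,
      (λ P' → map₂ (EF-sym q) (answerSet q (Perm.flip π) H' H ρ' σ' ρ σ flipped P'))
      where
      -- Moves in the right-hand sum are answered by the symmetric strategy.
      flipped : PiecewiseEF (Perm.flip π) H' H (suc q) ρ' σ' ρ σ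
      flipped = PiecewiseEF-flip (suc q) π H H' {ρ = ρ} {σ} {ρ'} {σ'} hyp

    -- Spoiler picks v in piece i: Duplicator answers in piece π i following the
    -- game on that pair; in every other pair of pieces the new variable is
    -- undefined on both sides.
    answerVertex : ∀ q π H H' {m ℓ} (ρ : Asg (⨁ H) m) (σ : Sets (⨁ H) ℓ) (ρ' : Asg (⨁ H') m) (σ' : Sets (⨁ H') ℓ) →
      PiecewiseEF π H H' (suc q) ρ σ ρ' σ' → ∀ a → ∃[ b ] EF q (⨁ H) (⨁ H') (just a ∷ ρ) σ (just b ∷ ρ') σ'
    answerVertex q π H H' ρ σ ρ' σ' hyp (i , v) =
      (π ⟨$⟩ʳ i , v') , EF-sum q π H H' _ σ _ σ' piecewise
      where
      v' : car (H' (π ⟨$⟩ʳ i))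
      v' = proj₁ (proj₁ (proj₂ (hyp i)) v)
      piecewise : PiecewiseEF π H H' q (just (i , v) ∷ ρ) σ (just (π ⟨$⟩ʳ i , v') ∷ ρ') σ'
      piecewise l with l ≟ i
      ... | yes refl =
        EF-cong q (restrict-∷ H i _ ρ (restrict-same H i v)) (λ _ _ → refl)
                  (restrict-∷ H' (π ⟨$⟩ʳ i) _ ρ' (restrict-same H' (π ⟨$⟩ʳ i) v')) (λ _ _ → refl)
                  (proj₂ (proj₁ (proj₂ (hyp i)) v))
      ... | no l≢i =
        EF-cong q (restrict-∷ H l _ ρ (restrict-other H l i v (l≢i ∘ sym))) (λ _ _ → refl)
                  (restrict-∷ H' (π ⟨$⟩ʳ l) _ ρ' (restrict-other H' (π ⟨$⟩ʳ l) (π ⟨$⟩ʳ i) v'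
                                                  (l≢i ∘ sym ∘ π-injective π H H')))
                  (λ _ _ → refl)
                  (EF-undefined q (EF-suc⇒EF q (hyp l)))

    -- Spoiler picks a set P: Duplicator answers on each piece π i with the
    -- answer to the restriction of P to piece i, and takes their union.
    answerSet : ∀ q π H H' {m ℓ} (ρ : Asg (⨁ H) m) (σ : Sets (⨁ H) ℓ) (ρ' : Asg (⨁ H') m) (σ' : Sets (⨁ H') ℓ) →
      PiecewiseEF π H H' (suc q) ρ σ ρ' σ' → ∀ (P : car (⨁ H) → Bool) →
      ∃[ P' ] EF q (⨁ H) (⨁ H') ρ (P ∷ σ) ρ' (P' ∷ σ')
    answerSet q π H H' ρ σ ρ' σ' hyp P = P' , EF-sum q π H H' ρ (P ∷ σ) ρ' (P' ∷ σ') piecewise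
      where
      answer : (i : Fin n) → car (H' (π ⟨$⟩ʳ i)) → Bool
      answer i = proj₁ (proj₁ (proj₂ (proj₂ (proj₂ (hyp i)))) (λ v → P (i , v)))
      P' : car (⨁ H') → Bool
      P' (j , w) = answer (π ⟨$⟩ˡ j) (subst (car ∘ H') (sym (inverseʳ π)) w)
      answer-transport : ∀ {i i'} (e : i' ≡ i) (p : π ⟨$⟩ʳ i' ≡ π ⟨$⟩ʳ i) w →
        answer i' (subst (car ∘ H') (sym p) w) ≡ answer i w
      answer-transport refl refl w = refl
      piecewise : PiecewiseEF π H H' q ρ (P ∷ σ) ρ' (P' ∷ σ')
      piecewise l = EF-cong q (λ _ → refl) restrictLeft (λ _ → refl) restrictRight
                      (proj₂ (proj₁ (proj₂ (proj₂ (proj₂ (hyp l)))) (λ v → P (l , v))))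
        where
        restrictLeft : ((λ v → P (l , v)) ∷ restrictSets H l σ) ≗₂ restrictSets H l (P ∷ σ)
        restrictLeft zero    v = refl
        restrictLeft (suc Z) v = refl
        restrictRight : (answer l ∷ restrictSets H' (π ⟨$⟩ʳ l) σ') ≗₂ restrictSets H' (π ⟨$⟩ʳ l) (P' ∷ σ')
        restrictRight zero    w = sym (answer-transport (inverseˡ π) (inverseʳ π) w)
        restrictRight (suc Z) w = refl

portStructure : ∀ {k} → PortGraph k → Structure k
portStructure p = graphStructure (graph p) (port p)

module _ {k : ℕ} (R : PortRel k) where

  Pieces : ∀ n → (Fin n → PortGraph k) → Set
  Pieces n H = Sum.SumCar {k} {n} R (portStructure ∘ H)

  pieceEdge : ∀ n (H : Fin n → PortGraph k) → Pieces n H → Pieces n H → Bool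
  pieceEdge n H = Sum.sumEdge {k} {n} R (portStructure ∘ H)

  private
    W : ∀ n → (Fin n → PortGraph k) → PortGraph k
    W n H = ⨂[ R ] n H

  decode : ∀ n (H : Fin n → PortGraph k) → V (graph (W n H)) → Pieces n H
  decode (suc n) H x with splitAt (size (graph (H zero))) x
  ... | inj₁ a = zero , a
  ... | inj₂ b = let i , w = decode n (H ∘ suc) b in suc i , w

  encode : ∀ n (H : Fin n → PortGraph k) → Pieces n H → V (graph (W n H))
  encode (suc n) H (zero , a)  = a ↑ˡ _
  encode (suc n) H (suc i , w) = size (graph (H zero)) ↑ʳ encode n (H ∘ suc) (i , w)

  decode-encode : ∀ n H p → decode n H (encode n H p) ≡ p
  decode-encode (suc n) H (zero , a)
    rewrite splitAt-↑ˡ (size (graph (H zero))) a (size (graph (W n (H ∘ suc)))) = refl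
  decode-encode (suc n) H (suc i , w)
    rewrite splitAt-↑ʳ (size (graph (H zero))) (size (graph (W n (H ∘ suc)))) (encode n (H ∘ suc) (i , w))
          | decode-encode n (H ∘ suc) (i , w) = refl

  encode-decode : ∀ n H x → encode n H (decode n H x) ≡ x
  encode-decode (suc n) H x with splitAt (size (graph (H zero))) x in eq
  ... | inj₁ a = splitAt⁻¹-↑ˡ eq
  ... | inj₂ b = trans (cong (size (graph (H zero)) ↑ʳ_) (encode-decode n (H ∘ suc) b)) (splitAt⁻¹-↑ʳ eq)

  port-encode : ∀ n H p → port (W n H) (encode n H p) ≡ port (H (proj₁ p)) (proj₂ p)
  port-encode (suc n) H (zero , a)
    rewrite splitAt-↑ˡ (size (graph (H zero))) a (size (graph (W n (H ∘ suc)))) = refl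
  port-encode (suc n) H (suc i , w)
    rewrite splitAt-↑ʳ (size (graph (H zero))) (size (graph (W n (H ∘ suc)))) (encode n (H ∘ suc) (i , w))
    = port-encode n (H ∘ suc) (i , w)

  pieceEdge-suc : ∀ n H i j v w → pieceEdge (suc n) H (suc i , v) (suc j , w) ≡ pieceEdge n (H ∘ suc) (i , v) (j , w)
  pieceEdge-suc n H i j v w with i ≟ j
  ... | yes refl = refl
  ... | no _     = refl

  adj-encode : ∀ n H p q → adj (graph (W n H)) (encode n H p) (encode n H q) ≡ pieceEdge n H p q
  adj-encode (suc n) H (zero , a) (zero , b)
    rewrite splitAt-↑ˡ (size (graph (H zero))) a (size (graph (W n (H ∘ suc))))
          | splitAt-↑ˡ (size (graph (H zero))) b (size (graph (W n (H ∘ suc)))) = refl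
  adj-encode (suc n) H (zero , a) (suc j , w)
    rewrite splitAt-↑ˡ (size (graph (H zero))) a (size (graph (W n (H ∘ suc))))
          | splitAt-↑ʳ (size (graph (H zero))) (size (graph (W n (H ∘ suc)))) (encode n (H ∘ suc) (j , w))
          | port-encode n (H ∘ suc) (j , w) = refl
  adj-encode (suc n) H (suc i , v) (zero , b)
    rewrite splitAt-↑ʳ (size (graph (H zero))) (size (graph (W n (H ∘ suc)))) (encode n (H ∘ suc) (i , v))
          | splitAt-↑ˡ (size (graph (H zero))) b (size (graph (W n (H ∘ suc))))
          | port-encode n (H ∘ suc) (i , v) = refl
  adj-encode (suc n) H (suc i , v) (suc j , w)
    rewrite splitAt-↑ʳ (size (graph (H zero))) (size (graph (W n (H ∘ suc)))) (encode n (H ∘ suc) (i , v))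
          | splitAt-↑ʳ (size (graph (H zero))) (size (graph (W n (H ∘ suc)))) (encode n (H ∘ suc) (j , w))
    = trans (adj-encode n (H ∘ suc) (i , v) (j , w)) (sym (pieceEdge-suc n H i j v w))

  ⨂≃⨁ : ∀ n H → portStructure (⨂[ R ] n H) ≃ Sum.⨁ {k} {n} R (portStructure ∘ H)
  ⨂≃⨁ n H = record
    { to      = decode n H
    ; from    = encode n H
    ; to-from = decode-encode n H
    ; from-to = encode-decode n H
    ; edge    = λ x y → trans (cong₂ (adj (graph (W n H))) (sym (encode-decode n H x)) (sym (encode-decode n H y)))
                              (adj-encode n H (decode n H x) (decode n H y))
    ; colour  = λ x → trans (cong (port (W n H)) (sym (encode-decode n H x))) (port-encode n H (decode n H x))
    }

≃-trans : ∀ {k} {A B C : Structure k} → A ≃ B → B ≃ C → A ≃ C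
≃-trans f g = record
  { to      = G.to ∘ F.to
  ; from    = F.from ∘ G.from
  ; to-from = λ c → trans (cong G.to (F.to-from (G.from c))) (G.to-from c)
  ; from-to = λ a → trans (cong F.from (G.from-to (F.to a))) (F.from-to a)
  ; edge    = λ a a' → trans (F.edge a a') (G.edge (F.to a) (F.to a'))
  ; colour  = λ a → trans (F.colour a) (G.colour (F.to a))
  }
  where module F = _≃_ f ; module G = _≃_ g

≅⇒≃ : ∀ {k} G (W : PortGraph k) (iso : G ≅ graph W) →
  graphStructure G (port W ∘ Bijection.to (proj₁ iso)) ≃ portStructure W
≅⇒≃ G W (bij , edge) = record
  { to      = Inverse.to inv
  ; from    = Inverse.from inv
  ; to-from = Inverse.strictlyInverseˡ inv
  ; from-to = Inverse.strictlyInverseʳ inv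
  ; edge    = edge
  ; colour  = λ _ → refl
  }
  where
  inv : Inverse (setoid (V G)) (setoid (V (graph W)))
  inv = ⤖⇒↔ bij

bit : Bool → Fin 2
bit false = zero
bit true  = suc zero

bit-injective : ∀ {a b} → bit a ≡ bit b → a ≡ b
bit-injective {false} {false} _ = refl
bit-injective {true}  {true}  _ = refl

funToFin-injective : ∀ {a m} (f g : Fin m → Fin a) → funToFin f ≡ funToFin g → f ≗ g
funToFin-injective f g e x =
  trans (sym (finToFun-funToFin f x)) (trans (cong (λ c → finToFun c x) e) (finToFun-funToFin g x))

witness : ∀ {P : Set} (d : Dec P) → does d ≡ true → P
witness (yes p) _ = p

numAtomTypes : ℕ → ℕ → ℕ → ℕ
numAtomTypes k m ℓ = suc (k * 2 ^ ℓ) ^ m * ((2 * 2) ^ m) ^ m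

numTypes : ℕ → ℕ → ℕ → ℕ → ℕ
numTypes k zero    m ℓ = numAtomTypes k m ℓ
numTypes k (suc q) m ℓ = numAtomTypes k m ℓ * (2 ^ numTypes k q (suc m) ℓ * 2 ^ numTypes k q m (suc ℓ))

-- The rank-q type of a coloured graph with assignments, as a number below
-- numTypes: the atomic type, together with the sets of rank-(q-1) types
-- reachable by one vertex move and by one set move.  Equal types mean that
-- Duplicator wins q rounds (typeCode⇒EF), so there are only finitely many
-- classes.
module Types {k : ℕ} (G : Graph) (c : V G → Fin k) where

  vertexCode : ∀ {ℓ} → Sets (graphStructure G c) ℓ → Maybe (V G) → Fin (suc (k * 2 ^ ℓ))
  vertexCode σ nothing  = zero
  vertexCode σ (just v) = suc (combine (c v) (funToFin (λ Z → bit (σ Z v))))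

  pairCode : Maybe (V G) → Maybe (V G) → Fin (2 * 2)
  pairCode (just u) (just w) = combine (bit (adj G u w)) (bit (does (u ≟ w)))
  pairCode _        _        = zero

  atomCode : ∀ {m ℓ} → Asg (graphStructure G c) m → Sets (graphStructure G c) ℓ → Fin (numAtomTypes k m ℓ)
  atomCode ρ σ = combine (funToFin (vertexCode σ ∘ ρ)) (funToFin (λ x → funToFin (λ y → pairCode (ρ x) (ρ y))))

  typeCode : ∀ q {m ℓ} → Asg (graphStructure G c) m → Sets (graphStructure G c) ℓ → Fin (numTypes k q m ℓ)
  typeCode zero    ρ σ = atomCode ρ σ
  typeCode (suc q) ρ σ =
    combine (atomCode ρ σ)
            (combine (funToFin (λ t → bit (does (any? (λ a → typeCode q (just a ∷ ρ) σ ≟ t)))))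
                     (funToFin (λ t → bit (does (anySubset? (λ ps → typeCode q ρ (lookup ps ∷ σ) ≟ t))))))

transfer : ∀ {X Y : Set} {N} (f : X → Fin N) (g : Y → Fin N)
  (dX : ∀ t → Dec (∃ λ x → f x ≡ t)) (dY : ∀ t → Dec (∃ λ y → g y ≡ t)) →
  (∀ t → bit (does (dX t)) ≡ bit (does (dY t))) → ∀ x → ∃ λ y → g y ≡ f x
transfer f g dX dY e x = witness (dY (f x)) (trans (sym (bit-injective (e (f x)))) (dec-true (dX (f x)) (x , refl)))

module _ {k : ℕ} {G G' : Graph} {c : V G → Fin k} {c' : V G' → Fin k} where
  open Types

  private
    A B : Structure k
    A = graphStructure G c
    B = graphStructure G' c'

  vertexCode⇒SameVertex : ∀ {ℓ} (σ : Sets A ℓ) (σ' : Sets B ℓ) u u' →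
    vertexCode G c σ u ≡ vertexCode G' c' σ' u' → SameVertex A B σ σ' u u'
  vertexCode⇒SameVertex σ σ' nothing  nothing   _  = tt
  vertexCode⇒SameVertex σ σ' (just v) (just v') e =
    let ec , eσ = combine-injective (c v) _ (c' v') _ (suc-injective e) in
    ec , λ Z → bit-injective (funToFin-injective _ _ eσ Z)

  pairCode⇒SamePair : ∀ u v u' v' → pairCode G c u v ≡ pairCode G' c' u' v' → SamePair A B u v u' v'
  pairCode⇒SamePair (just a) (just b) (just a') (just b') e refl refl refl refl =
    let eE , e≟ = combine-injective (bit (adj G a b)) _ (bit (adj G' a' b')) _ e in
    bit-injective eE ,
    (λ p → witness (a' ≟ b') (trans (sym (bit-injective e≟)) (dec-true (a ≟ b) p))) ,
    (λ p → witness (a ≟ b) (trans (bit-injective e≟) (dec-true (a' ≟ b') p)))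

  atomCode⇒SameAtoms : ∀ {m ℓ} (ρ : Asg A m) (σ : Sets A ℓ) (ρ' : Asg B m) (σ' : Sets B ℓ) →
    atomCode G c ρ σ ≡ atomCode G' c' ρ' σ' → SameAtoms A B ρ σ ρ' σ'
  atomCode⇒SameAtoms ρ σ ρ' σ' e =
    let ev , ep = combine-injective (funToFin (vertexCode G c σ ∘ ρ)) _ (funToFin (vertexCode G' c' σ' ∘ ρ')) _ e in
    (λ x → vertexCode⇒SameVertex σ σ' (ρ x) (ρ' x) (funToFin-injective _ _ ev x)) ,
    λ x y → pairCode⇒SamePair (ρ x) (ρ y) (ρ' x) (ρ' y)
              (funToFin-injective _ _ (funToFin-injective _ _ ep x) y)

  typeCode⇒EF : ∀ q {m ℓ} (ρ : Asg A m) (σ : Sets A ℓ) (ρ' : Asg B m) (σ' : Sets B ℓ) →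
    typeCode G c q ρ σ ≡ typeCode G' c' q ρ' σ' → EF q A B ρ σ ρ' σ'
  typeCode⇒EF zero    ρ σ ρ' σ' e = atomCode⇒SameAtoms ρ σ ρ' σ' e
  typeCode⇒EF (suc q) {m} {ℓ} ρ σ ρ' σ' e =
    atomCode⇒SameAtoms ρ σ ρ' σ' (proj₁ splitType) , forthVertex , backVertex , forthSet , backSet
    where
    moveL : V G → Fin (numTypes k q (suc m) ℓ)
    moveL a = typeCode G c q (just a ∷ ρ) σ
    moveR : V G' → Fin (numTypes k q (suc m) ℓ)
    moveR b = typeCode G' c' q (just b ∷ ρ') σ'
    setL : Subset (size G) → Fin (numTypes k q m (suc ℓ))
    setL ps = typeCode G c q ρ (lookup ps ∷ σ)
    setR : Subset (size G') → Fin (numTypes k q m (suc ℓ))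
    setR ps = typeCode G' c' q ρ' (lookup ps ∷ σ')

    reaches : ∀ {n N} (f : Fin n → Fin N) t → Dec (∃ λ a → f a ≡ t)
    reaches f t = any? (λ a → f a ≟ t)
    reachesSet : ∀ {n N} (f : Subset n → Fin N) t → Dec (∃ λ ps → f ps ≡ t)
    reachesSet f t = anySubset? (λ ps → f ps ≟ t)

    movesL movesR : Fin (2 ^ numTypes k q (suc m) ℓ * 2 ^ numTypes k q m (suc ℓ))
    movesL = combine (funToFin (λ t → bit (does (reaches moveL t)))) (funToFin (λ t → bit (does (reachesSet setL t))))
    movesR = combine (funToFin (λ t → bit (does (reaches moveR t)))) (funToFin (λ t → bit (does (reachesSet setR t))))
    splitType : atomCode G c ρ σ ≡ atomCode G' c' ρ' σ' × movesL ≡ movesR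
    splitType = combine-injective (atomCode G c ρ σ) movesL (atomCode G' c' ρ' σ') movesR e
    splitMoves : funToFin (λ t → bit (does (reaches moveL t))) ≡ funToFin (λ t → bit (does (reaches moveR t))) ×
                 funToFin (λ t → bit (does (reachesSet setL t))) ≡ funToFin (λ t → bit (does (reachesSet setR t)))
    splitMoves = combine-injective _ _ _ _ (proj₂ splitType)
    vertexMoves : ∀ t → bit (does (reaches moveL t)) ≡ bit (does (reaches moveR t))
    vertexMoves = funToFin-injective _ _ (proj₁ splitMoves)
    setMoves : ∀ t → bit (does (reachesSet setL t)) ≡ bit (does (reachesSet setR t))
    setMoves = funToFin-injective _ _ (proj₂ splitMoves)

    tabulated : ∀ {n} {σ₀ : Fin ℓ → Fin n → Bool} (P : Fin n → Bool) → (lookup (tabulate P) ∷ σ₀) ≗₂ (P ∷ σ₀)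
    tabulated P zero    a = lookup∘tabulate P a
    tabulated P (suc Z) a = refl

    forthVertex : ∀ a → ∃[ b ] EF q A B (just a ∷ ρ) σ (just b ∷ ρ') σ'
    forthVertex a = let b , p = transfer moveL moveR (reaches moveL) (reaches moveR) vertexMoves a in b , typeCode⇒EF q _ σ _ σ' (sym p)
    backVertex : ∀ b → ∃[ a ] EF q A B (just a ∷ ρ) σ (just b ∷ ρ') σ'
    backVertex b = let a , p = transfer moveR moveL (reaches moveR) (reaches moveL) (sym ∘ vertexMoves) b in a , typeCode⇒EF q _ σ _ σ' p
    forthSet : ∀ P → ∃[ P' ] EF q A B ρ (P ∷ σ) ρ' (P' ∷ σ')
    forthSet P = let ps , p = transfer setL setR (reachesSet setL) (reachesSet setR) setMoves (tabulate P) in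
      lookup ps , EF-cong q (λ _ → refl) (tabulated P) (λ _ → refl) (λ _ _ → refl) (typeCode⇒EF q ρ _ ρ' _ (sym p))
    backSet : ∀ P' → ∃[ P ] EF q A B ρ (P ∷ σ) ρ' (P' ∷ σ')
    backSet P' = let ps , p = transfer setR setL (reachesSet setR) (reachesSet setL) (sym ∘ setMoves) (tabulate P') in
      lookup ps , EF-cong q (λ _ → refl) (λ _ _ → refl) (λ _ → refl) (tabulated P') (typeCode⇒EF q ρ _ ρ' _ p)

n<2^n : ∀ n → n < 2 ^ n
n<2^n zero    = s≤s z≤n
n<2^n (suc n) = begin-strict
    suc n          <⟨ +-mono-≤-< (m^n>0 2 n) (n<2^n n) ⟩
    2 ^ n + 2 ^ n  ≡⟨ cong (2 ^ n +_) (sym (+-identityʳ (2 ^ n))) ⟩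
    2 ^ suc n      ∎
  where open ≤-Reasoning

n+n≤2^n : ∀ n → n + n ≤ 2 ^ n
n+n≤2^n zero          = z≤n
n+n≤2^n (suc zero)    = s≤s (s≤s z≤n)
n+n≤2^n (suc (suc n)) = begin
    suc (suc n) + suc (suc n)  ≡⟨ cong suc (+-suc (suc n) (suc n)) ⟩
    2 + (suc n + suc n)        ≤⟨ +-mono-≤ (*-monoʳ-≤ 2 (m^n>0 2 n)) (n+n≤2^n (suc n)) ⟩
    2 ^ suc n + 2 ^ suc n      ≡⟨ cong (2 ^ suc n +_) (sym (+-identityʳ (2 ^ suc n))) ⟩
    2 ^ suc (suc n)            ∎
  where open ≤-Reasoning

exp-mono-height : ∀ {i j} n → i ≤ j → exp i n ≤ exp j n
exp-mono-height {zero}  {zero}  n _ = ≤-refl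
exp-mono-height {zero}  {suc j} n _ = ≤-trans (exp-mono-height {zero} {j} n z≤n) (<⇒≤ (n<2^n (exp j n)))
exp-mono-height {suc i} {suc j} n (s≤s i≤j) = ^-monoʳ-≤ 2 (exp-mono-height n i≤j)

c≤exp : ∀ c n → c ≤ exp c n
c≤exp zero    n = z≤n
c≤exp (suc c) n = ≤-trans (s≤s (c≤exp c n)) (n<2^n (exp c n))

bound-⊔ˡ : ∀ {f : ℕ → ℕ} i j → (∀ n → f n ≤ exp i n) → ∀ n → f n ≤ exp (i ⊔ j) n
bound-⊔ˡ i j h n = ≤-trans (h n) (exp-mono-height n (m≤m⊔n i j))

bound-⊔ʳ : ∀ {f : ℕ → ℕ} i j → (∀ n → f n ≤ exp j n) → ∀ n → f n ≤ exp (i ⊔ j) n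
bound-⊔ʳ i j h n = ≤-trans (h n) (exp-mono-height n (m≤n⊔m i j))

elem-const : ∀ c → Elementary (λ _ → c)
elem-const c = c , c≤exp c

elem-id : Elementary (λ n → n)
elem-id = 0 , λ n → ≤-refl

elem-+ : ∀ f g → Elementary f → Elementary g → Elementary (λ n → f n + g n)
elem-+ f g (i , hf) (j , hg) = suc (i ⊔ j) , λ n →
  ≤-trans (+-mono-≤ (bound-⊔ˡ i j hf n) (bound-⊔ʳ i j hg n)) (n+n≤2^n (exp (i ⊔ j) n))

elem-2^ : ∀ f → Elementary f → Elementary (λ n → 2 ^ f n)
elem-2^ f (i , hf) = suc i , λ n → ^-monoʳ-≤ 2 (hf n)

elem-* : ∀ f g → Elementary f → Elementary g → Elementary (λ n → f n * g n)
elem-* f g ef eg with elem-2^ (λ n → f n + g n) (elem-+ f g ef eg)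
... | j , h = j , λ n → begin
    f n * g n          ≤⟨ *-mono-≤ (<⇒≤ (n<2^n (f n))) (<⇒≤ (n<2^n (g n))) ⟩
    2 ^ f n * 2 ^ g n  ≡⟨ sym (^-distribˡ-+-* 2 (f n) (g n)) ⟩
    2 ^ (f n + g n)    ≤⟨ h n ⟩
    exp j n            ∎
  where open ≤-Reasoning

elem-^ : ∀ f c → Elementary f → Elementary (λ n → f n ^ c)
elem-^ f zero    ef = elem-const 1
elem-^ f (suc c) ef = elem-* f (λ n → f n ^ c) ef (elem-^ f c ef)

elem-numAtomTypes : ∀ m ℓ → Elementary (λ k → numAtomTypes k m ℓ)
elem-numAtomTypes m ℓ =
  elem-* _ _ (elem-^ _ m (elem-+ _ _ (elem-const 1) (elem-* _ _ elem-id (elem-const (2 ^ ℓ)))))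
             (elem-const (((2 * 2) ^ m) ^ m))

elem-numTypes : ∀ q m ℓ → Elementary (λ k → numTypes k q m ℓ)
elem-numTypes zero    m ℓ = elem-numAtomTypes m ℓ
elem-numTypes (suc q) m ℓ =
  elem-* _ _ (elem-numAtomTypes m ℓ)
             (elem-* _ _ (elem-2^ _ (elem-numTypes q (suc m) ℓ)) (elem-2^ _ (elem-numTypes q m (suc ℓ))))

module _ {n : ℕ} (i j : Fin n) where
  transpose-i : Perm.transpose i j ⟨$⟩ʳ i ≡ j
  transpose-i rewrite dec-true (i ≟ i) refl = refl

  transpose-j : ¬ i ≡ j → Perm.transpose i j ⟨$⟩ʳ j ≡ i
  transpose-j i≢j rewrite dec-false (j ≟ i) (i≢j ∘ sym) | dec-true (j ≟ j) refl = refl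

  transpose-other : ∀ l → ¬ l ≡ i → ¬ l ≡ j → Perm.transpose i j ⟨$⟩ʳ l ≡ l
  transpose-other l l≢i l≢j rewrite dec-false (l ≟ i) l≢i | dec-false (l ≟ j) l≢j = refl

onlyFirst onlySecond : Fin 2 → Maybe (Fin 1)
onlyFirst zero    = just zero
onlyFirst (suc _) = nothing
onlySecond zero    = nothing
onlySecond (suc _) = just zero

-- If Duplicator wins d rounds on piece i with a vertex a and
-- piece j ≠ i with a vertex b, then she wins d rounds on the sum between the
-- pairs ((i,a),(j,b)) and ((j,b),(i,a)): compose along the transposition of i
-- and j, using the given game on {i, j} and the trivial game elsewhere.
module _ {k n : ℕ} (R : PortRel k) (H : Fin n → Structure k) where
  open Sum {k} {n} R

  EF-swap : ∀ d {ℓ} (σ : Sets (⨁ H) ℓ) i j → ¬ i ≡ j → ∀ a b →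
    EF d (H i) (H j) (just a ∷ []) (restrictSets H i σ) (just b ∷ []) (restrictSets H j σ) →
    EF d (⨁ H) (⨁ H) (just (i , a) ∷ just (j , b) ∷ []) σ (just (j , b) ∷ just (i , a) ∷ []) σ
  EF-swap d {ℓ} σ i j i≢j a b e =
    EF-sum d (Perm.transpose i j) H H ρ σ ρ' σ (λ l → piece l (l ≟ i) (l ≟ j))
    where
    ρ ρ' : Asg (⨁ H) 2
    ρ  = just (i , a) ∷ just (j , b) ∷ []
    ρ' = just (j , b) ∷ just (i , a) ∷ []
    Goal : Fin n → Fin n → Set
    Goal l t = EF d (H l) (H t) (restrict H l ∘ ρ) (restrictSets H l σ) (restrict H t ∘ ρ') (restrictSets H t σ)
    pieceI : Goal i j
    pieceI = EF-cong d left (λ _ _ → refl) right (λ _ _ → refl) (EF-rename d onlyFirst e)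
      where
      left : rename onlyFirst (just a ∷ []) ≗ restrict H i ∘ ρ
      left zero       = sym (restrict-same H i a)
      left (suc zero) = sym (restrict-other H i j b (i≢j ∘ sym))
      right : rename onlyFirst (just b ∷ []) ≗ restrict H j ∘ ρ'
      right zero       = sym (restrict-same H j b)
      right (suc zero) = sym (restrict-other H j i a i≢j)
    pieceJ : Goal j i
    pieceJ = EF-cong d left (λ _ _ → refl) right (λ _ _ → refl) (EF-sym d (EF-rename d onlySecond e))
      where
      left : rename onlySecond (just b ∷ []) ≗ restrict H j ∘ ρ
      left zero       = sym (restrict-other H j i a i≢j)
      left (suc zero) = sym (restrict-same H j b)
      right : rename onlySecond (just a ∷ []) ≗ restrict H i ∘ ρ'
      right zero       = sym (restrict-other H i j b (i≢j ∘ sym))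
      right (suc zero) = sym (restrict-same H i a)
    pieceOther : ∀ l → ¬ l ≡ i → ¬ l ≡ j → Goal l l
    pieceOther l l≢i l≢j = EF-cong d undefinedL (λ _ _ → refl) undefinedR (λ _ _ → refl) (EF-refl d (λ _ → nothing) _)
      where
      undefinedL : (λ _ → nothing) ≗ restrict H l ∘ ρ
      undefinedL zero       = sym (restrict-other H l i a (l≢i ∘ sym))
      undefinedL (suc zero) = sym (restrict-other H l j b (l≢j ∘ sym))
      undefinedR : (λ _ → nothing) ≗ restrict H l ∘ ρ'
      undefinedR zero       = sym (restrict-other H l j b (l≢j ∘ sym))
      undefinedR (suc zero) = sym (restrict-other H l i a (l≢i ∘ sym))
    piece : ∀ l → Dec (l ≡ i) → Dec (l ≡ j) → Goal l (Perm.transpose i j ⟨$⟩ʳ l)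
    piece l (yes refl) _          = subst (Goal l) (sym (transpose-i i j)) pieceI
    piece l (no _)     (yes refl) = subst (Goal l) (sym (transpose-j i j i≢j)) pieceJ
    piece l (no l≢i)   (no l≢j)   = subst (Goal l) (sym (transpose-other i j l l≢i l≢j)) (pieceOther l l≢i l≢j)

pair-just : ∀ {X : Set} (x y : X) (ρ₀ : Fin 0 → X) → (just x ∷ just y ∷ []) ≗ just ∘ (x ∷ y ∷ ρ₀)
pair-just x y ρ₀ zero       = refl
pair-just x y ρ₀ (suc zero) = refl

-- Otherwise the
-- corresponding vertices of G would be related by the order in both
-- directions, contradicting antisymmetry.
ordered⇒noSwap : ∀ {k ℓ} (G : Graph) (c : V G → Fin k) (B : Structure k) (iso : graphStructure G c ≃ B)
  (φ : Formula 2 ℓ) (P : Fin ℓ → VSet G) → IsTotalOrder _≡_ (Rel[ G , φ , P ]) →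
  let open _≃_ iso in
  ∀ p q → EF (depth φ) B B (just p ∷ just q ∷ []) (λ Z → P Z ∘ from) (just q ∷ just p ∷ []) (λ Z → P Z ∘ from) →
  p ≡ q
ordered⇒noSwap {k} G c B iso φ P order p q swapped =
  trans (sym (to-from p)) (trans (cong to (antisym (proj₁ both) (proj₂ both))) (to-from q))
  where
  open _≃_ iso
  open IsTotalOrder order using (total; antisym)
  d : ℕ
  d = depth φ
  A : Structure k
  A = graphStructure G c
  a₀ b₀ : V G
  a₀ = from p
  b₀ = from q
  toG : ∀ x y → EF d A B (just (from x) ∷ just (from y) ∷ []) P (just x ∷ just y ∷ []) (λ Z → P Z ∘ from)
  toG x y = EF-iso iso d _ P _ _ along (λ Z a → cong (P Z) (from-to a))
    where
    along : (just x ∷ just y ∷ []) ≗ Maybe.map to ∘ (just (from x) ∷ just (from y) ∷ [])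
    along zero       = cong just (sym (to-from x))
    along (suc zero) = cong just (sym (to-from y))
  swappedG : EF d A A (just a₀ ∷ just b₀ ∷ []) P (just b₀ ∷ just a₀ ∷ []) P
  swappedG = EF-trans d (toG p q) (EF-trans d swapped (EF-sym d (toG q p)))
  symmetric : Rel[ G , φ , P ] a₀ b₀ ⇔ Rel[ G , φ , P ] b₀ a₀
  symmetric = EF⇒Sat d φ ≤-refl _ P _ P
                (EF-cong d (pair-just a₀ b₀ _) (λ _ _ → refl) (pair-just b₀ a₀ _) (λ _ _ → refl) swappedG)
  both : Rel[ G , φ , P ] a₀ b₀ × Rel[ G , φ , P ] b₀ a₀
  both with total a₀ b₀
  ... | inj₁ r = r , Equivalence.to symmetric r
  ... | inj₂ r = Equivalence.from symmetric r , r

twoEquivalentPieces : ∀ {k n} d ℓ (H : Fin n → PortGraph k) (σ : ∀ i → Sets (portStructure (H i)) ℓ) →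
  (∀ i → Nonempty (graph (H i))) → numTypes k (suc d) 0 ℓ < n →
  ∃[ i ] ∃[ j ] ¬ i ≡ j × ∃[ a ] ∃[ b ]
    EF d (portStructure (H i)) (portStructure (H j)) (just a ∷ []) (σ i) (just b ∷ []) (σ j)
twoEquivalentPieces {k} d ℓ H σ nonempty N<n =
  let i , j , i<j , sameType = pigeonhole N<n type
      _ , forth , _ = typeCode⇒EF (suc d) [] (σ i) [] (σ j) sameType
      a = fromℕ< (nonempty i)
      b , e = forth a
  in i , j , <⇒≢ i<j , a , b , e
  where
  type : ∀ i → Fin (numTypes k (suc d) 0 ℓ)
  type i = Types.typeCode (graph (H i)) (port (H i)) (suc d) [] (σ i)

inhabited⇒nonempty : ∀ {m} → Fin m → 0 < m
inhabited⇒nonempty {suc m} _ = s≤s z≤n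

-- Otherwise two distinct pieces have the same type, and swapping them
-- contradicts the rigidity of the order (ordered⇒noSwap).
cutBound : ∀ {ℓ} (φ : Formula 2 ℓ) (G : Graph) →
  (Nonempty G → ∃[ P ] IsTotalOrder _≡_ (Rel[ G , φ , P ])) →
  ∀ k → Cut≤ G k (numTypes k (suc (depth φ)) 0 ℓ)
cutBound {ℓ} φ G ordered k n (H , R , pieces , G≅⨂) with n ≤? numTypes k (suc (depth φ)) 0 ℓ
... | yes n≤N = n≤N
... | no  n≰N =
  let P , order = ordered (inhabited⇒nonempty someVertex)
      i , j , i≢j , a , b , e = twoEquivalentPieces (depth φ) ℓ H (λ i → restrictSets Hs i (transport P)) (proj₁ ∘ pieces) N<n
      swapped = EF-swap R Hs (depth φ) (transport P) i j i≢j a b e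
  in contradiction (cong proj₁ (ordered⇒noSwap G _ (⨁ Hs) iso φ P order (i , a) (j , b) swapped)) i≢j
  where
  open Sum {k} {n} R using (⨁; restrictSets)
  Hs : Fin n → Structure k
  Hs = portStructure ∘ H
  iso : graphStructure G (port (⨂[ R ] n H) ∘ Bijection.to (proj₁ G≅⨂)) ≃ ⨁ Hs
  iso = ≃-trans (≅⇒≃ G (⨂[ R ] n H) G≅⨂) (⨂≃⨁ R n H)
  open _≃_ iso using (from)
  N<n : numTypes k (suc (depth φ)) 0 ℓ < n
  N<n = ≰⇒> n≰N
  someVertex : V G
  someVertex = from (first , fromℕ< (proj₁ (pieces first)))
    where
    first : Fin n
    first = fromℕ< (≤-trans (s≤s z≤n) N<n)
  transport : (Fin ℓ → VSet G) → Sets (⨁ Hs) ℓ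
  transport P Z = P Z ∘ from

-- Corollary 5.8: the bound of cutBound is elementary in k.
corollary5p8 : (C : Class) → (∀ G → C G → IsSimple G) → MSO₁-orderable C →
    ∃[ f ] (Elementary f × CUT f C)
corollary5p8 C _ (ℓ , φ , orderable) =
  (λ k → numTypes k (suc (depth φ)) 0 ℓ) ,
  elem-numTypes (suc (depth φ)) 0 ℓ ,
  λ G G∈C → cutBound φ G (orderable G G∈C)
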